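{- In the setting described in the context, the edge set $E$ contains a matching that matches a $(1-O(1/K))$ fraction of the vertices of $S$ to vertices of $T\setminus T_*$.
   Context: $[a]=\{0,\dots,a-1\}$, $\mathrm{wt}(x)=\sum_j x_j$. Let $K$ be an even positive integer, $m,W$ positive integers with $(K-s)\mid W$ and $W\mid m/(K-s)$ for all $s\in[K/2]$, and $J_0,\dots,J_{K/2}\in[n]$ pairwise distinct. $T=T_0=[m]^n$, $T_{k+1}=\{y\in T_k:y_{J_k}/m\in[0,1-\frac1{K-k})\}$, $T_*=T_{K/2}$. For $k\in[K/2]$, $S_k$ is a set of vertices in bijection with (labelled by) the points $\{x\in T_k:(\mathrm{wt}(x)\bmod W)\in[0,\frac{W}{K-k})\}$, and $S=S_0\uplus\dots\uplus S_{K/2-1}$ is their disjoint union (so a point may label vertices in several $S_k$). For $j\in[n]$: $T_k^j=\{y\in T_k:y_j/m\in[0,1-\frac1{K-k})\}$, $S_k^j$ = the vertices of $S_k$ whose label $x$ satisfies $x_j/m\in[0,1-\frac1{K-k})$. For each $k\in[K/2]$ let $D_k\subseteq[n]\setminus\{J_0,\dots,J_{k-1},J_{k+1},\dots,J_{K/2}\}$ be a set of coordinates containing $J_k$. The bipartite graph $G=(S,T,E)$ has $E=\bigcup_{k\in[K/2]}\bigcup_{j\in D_k}E_{k,j}$, where $E_{k,j}$ consists of all pairs $(u,v)$ with $u\in S_k^j$, $v\in T_k\setminus T_k^j$, such that the label of $u$ and $v$ agree on all coordinates other than $j$ (equivalently, for each line $\{x'\in[m]^n:x'_l=x_l\ \forall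 l\ne j\}$ a complete bipartite graph between its $S_k^j$-vertices and its points in $T_k\setminus T_k^j$). -}

module Defs where

open import Data.Nat using (ℕ; NonZero; zero; suc; _+_; _*_; _∸_; _<_; _<?_)
open import Data.Nat.DivMod using (_%_)
open import Data.Fin using (Fin; toℕ)
open import Data.Vec using (Vec; []; _∷_; lookup)
import Data.Vec as Vec
open import Data.List using (List; []; _∷_; map; concatMap; filter; upTo; length)
open import Data.Product using (_×_; _,_; ∃-syntax; proj₁; proj₂)
open import Data.Fin.Subset using (Subset; _∈_)
open import Relation.Nullary using (¬_)
open import Relation.Binary.PropositionalEquality using (_≡_; _≢_)
open import Data.List.Relation.Unary.All using (All)
open import Data.List.Relation.Unary.Unique.Propositional using (Unique)
open import Data.Unit using (⊤; tt)
open import Relation.Nullary using (Dec; yes)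
open import Relation.Nullary.Decidable using (_×-dec_)

Point : ℕ → ℕ → Set
Point m n = Vec (Fin m) n

allPoints : (m n : ℕ) → List (Point m n)
allPoints m zero = [] ∷ []
allPoints m (suc n) =
  concatMap (λ a → map (a ∷_) (allPoints m n)) (Data.List.allFin m)

wt : ∀ {m n} → Point m n → ℕ
wt x = Vec.sum (Vec.map toℕ x)

-- Good K m k a  :⇔  a/m ∈ [0, 1 - 1/(K-k))  ⇔  a·(K-k) < m·(K-k) - m
Good : (K m k : ℕ) → ℕ → Set
Good K m k a = a * (K ∸ k) + m < m * (K ∸ k)

good? : (K m k a : ℕ) → Dec (Good K m k a)
good? K m k a = (a * (K ∸ k) + m) <? (m * (K ∸ k))

InT : ∀ {n} (K m : ℕ) (J : ℕ → Fin n) → ℕ → Point m n → Set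
InT K m J zero y = ⊤
InT K m J (suc k) y = InT K m J k y × Good K m k (toℕ (lookup y (J k)))

inT? : ∀ {n} (K m : ℕ) (J : ℕ → Fin n) (k : ℕ) (y : Point m n) → Dec (InT K m J k y)
inT? K m J zero y = yes tt
inT? K m J (suc k) y = inT? K m J k y ×-dec good? K m k (toℕ (lookup y (J k)))

-- (wt(x) mod W) ∈ [0, W/(K-k))
WtCond : ∀ {m n} (K W k : ℕ) .⦃ _ : NonZero W ⦄ → Point m n → Set
WtCond K W k x = (wt x % W) * (K ∸ k) < W

InS : ∀ {n} (K m W : ℕ) .⦃ _ : NonZero W ⦄ (J : ℕ → Fin n) → ℕ → Point m n → Set
InS K m W J k x = InT K m J k x × WtCond K W k x

inS? : ∀ {n} (K m W : ℕ) .⦃ _ : NonZero W ⦄ (J : ℕ → Fin n) (k : ℕ) (x : Point m n) → Dec (InS K m W J k x)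
inS? K m W J k x = inT? K m J k x ×-dec ((wt x % W) * (K ∸ k) <? W)

-- The vertex set S = S_0 ⊎ ... ⊎ S_{h-1} (h = K/2), as the list of its
-- vertices (k , x), each vertex listed exactly once.
SVertices : ∀ {n} (h K m W : ℕ) .⦃ _ : NonZero W ⦄ (J : ℕ → Fin n) → List (ℕ × Point m n)
SVertices {n} h K m W J =
  concatMap (λ k → map (k ,_) (filter (inS? K m W J k) (allPoints m n))) (upTo h)

sizeS : ∀ {n} (h K m W : ℕ) .⦃ _ : NonZero W ⦄ (J : ℕ → Fin n) → ℕ
sizeS h K m W J = length (SVertices h K m W J)

IsEdge : ∀ {m n} (h K W : ℕ) .⦃ _ : NonZero W ⦄ (J : ℕ → Fin n) (D : ℕ → Subset n)
         → ℕ × Point m n → Point m n → Set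
IsEdge {m} h K W J D (k , x) y =
  k < h × InS K m W J k x × InT K m J k y ×
  (∃[ j ] (j ∈ D k × Good K m k (toℕ (lookup x j)) × ¬ Good K m k (toℕ (lookup y j))
           × (∀ l → l ≢ j → lookup x l ≡ lookup y l)))

-- A matching M ⊆ E (list of edges, pairwise vertex-disjoint) all of whose
-- T-endpoints lie in T \ T_* (T_* = T_{K/2} = T_h).
IsMatchingIntoT∖T* : ∀ {m n} (h K W : ℕ) .⦃ _ : NonZero W ⦄ (J : ℕ → Fin n) (D : ℕ → Subset n)
         → List ((ℕ × Point m n) × Point m n) → Set
IsMatchingIntoT∖T* {m} h K W J D M =
  All (λ e → IsEdge h K W J D (proj₁ e) (proj₂ e)) M
  × Unique (map proj₁ M)
  × Unique (map proj₂ M)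
  × All (λ e → ¬ InT K m J h (proj₂ e)) M

-- Fix a layer k < K/2 and put L = K − k, q = m/L, w = W/L; the vertices of S_k are the
-- points x ∈ T_k with wt x mod W < w. Call x good if x_{J_k} < m − q. On each line in
-- direction J_k the good points are mapped injectively into the last q positions, which lie in
-- T_k ∖ T_{k+1}: the new coordinate is (L − 1)q plus the residue of the weight mod W,
-- compressed by the factor L, which is injective because only residues below w = W/L occur.
-- Each bad point yields L distinct points of S_k by moving x_{J_k} by multiples of q (a multiple
-- of W), so at most |S_k|/L ≤ 2|S_k|/K points are bad. The sets T_k ∖ T_{k+1} are disjoint,
-- so the layer matchings together form a matching that misses at most 2|S|/K vertices of S.

module Submission where

open import Defs
open import Data.Nat using (ℕ; NonZero; >-nonZero; ≢-nonZero⁻¹; zero; suc; _+_; _*_; _∸_; _≤_; _<_; z≤n; s≤s; _<?_)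
open import Data.Nat.Properties
open import Algebra.Properties.CommutativeSemigroup +-commutativeSemigroup using () renaming (xy∙z≈xz∙y to +-right-comm)
open import Data.Nat.DivMod using (_/_; _%_; _mod_; m%n<n; m≡m%n+[m/n]*n; m<n⇒m%n≡m; [m+kn]%n≡m%n; m<n*o⇒m/o<n)
open import Data.Nat.Divisibility using (_∣_; divides)
open import Data.Nat.Tactic.RingSolver using (solve-∀)
open import Data.Fin using (Fin; toℕ) renaming (zero to fzero; suc to fsuc)
open import Data.Fin.Properties using (toℕ-injective; toℕ-fromℕ<; toℕ<n)
open import Data.Fin.Subset using (Subset) renaming (_∈_ to _∈ₛ_; _∉_ to _∉ₛ_)
open import Data.Vec using (Vec; []; _∷_; lookup; _[_]≔_)
open import Data.Vec.Properties using (lookup∘update; lookup∘update′; []≔-idempotent; []≔-lookup; ∷-injective)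
open import Data.List using (List; []; _∷_; _++_; map; concatMap; filter; length; upTo; cartesianProduct)
open import Data.List.Properties using (length-++; length-map; length-upTo; map-∘; map-id; map-concatMap)
open import Data.List.Membership.Propositional using (_∈_; find; lose)
open import Data.List.Membership.Propositional.Properties
  using (∈-map⁺; ∈-map⁻; ∈-concatMap⁺; ∈-concatMap⁻; ∈-∃++; ∈-filter⁺; ∈-filter⁻; ∈-allFin; ∈-upTo⁻; ∈-cartesianProduct⁻)
open import Data.List.Relation.Binary.Subset.Propositional using (_⊆_)
open import Data.List.Relation.Binary.Disjoint.Propositional using (Disjoint)
open import Data.List.Relation.Unary.Any using (here; there)
open import Data.List.Relation.Unary.All using (All; []; _∷_)
import Data.List.Relation.Unary.All as All
import Data.List.Relation.Unary.All.Properties as All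
open import Data.List.Relation.Unary.AllPairs using ([]; _∷_)
open import Data.List.Relation.Unary.Unique.Propositional using (Unique)
import Data.List.Relation.Unary.Unique.Propositional.Properties as Unique
open import Data.Product using (Σ; _×_; _,_; proj₁; proj₂; ∃-syntax)
open import Data.Unit using (tt)
open import Data.Sum using (inj₁; inj₂)
open import Function using (_∘_; _⇔_; mk⇔; Equivalence)
open import Relation.Nullary using (¬_; yes; no; ¬?; contradiction)
open import Level using (0ℓ)
open import Relation.Unary using (Pred; Decidable)
open import Relation.Binary.PropositionalEquality
open import Relation.Binary.Definitions using (tri<; tri≈; tri>)

module _ {A : Set} where

  private
    ∈-remove : ∀ {x z : A} ys zs → z ∈ ys ++ x ∷ zs → z ≢ x → z ∈ ys ++ zs
    ∈-remove []       zs (here z≡x) z≢x = contradiction z≡x z≢x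
    ∈-remove []       zs (there z∈)  _  = z∈
    ∈-remove (y ∷ ys) zs (here z≡y)  _  = here z≡y
    ∈-remove (y ∷ ys) zs (there z∈) z≢x = there (∈-remove ys zs z∈ z≢x)

  ⊆⇒length-≤ : ∀ {xs ys : List A} → Unique xs → xs ⊆ ys → length xs ≤ length ys
  ⊆⇒length-≤ {[]} _ _ = z≤n
  ⊆⇒length-≤ {x ∷ xs} (x≢xs ∷ u) xs⊆ys with ys₁ , ys₂ , refl ← ∈-∃++ (xs⊆ys (here refl)) = begin
    suc (length xs)                 ≤⟨ s≤s (⊆⇒length-≤ u xs⊆ys₁ys₂) ⟩
    suc (length (ys₁ ++ ys₂))       ≡⟨ cong suc (length-++ ys₁) ⟩
    suc (length ys₁ + length ys₂)   ≡⟨ +-suc (length ys₁) (length ys₂) ⟨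
    length ys₁ + length (x ∷ ys₂)   ≡⟨ length-++ ys₁ ⟨
    length (ys₁ ++ x ∷ ys₂)         ∎
    where
    open ≤-Reasoning
    xs⊆ys₁ys₂ : xs ⊆ ys₁ ++ ys₂
    xs⊆ys₁ys₂ z∈ = ∈-remove ys₁ ys₂ (xs⊆ys (there z∈)) (λ z≡x → All.lookup x≢xs z∈ (sym z≡x))

  length-filter-∁ : ∀ {P : Pred A 0ℓ} (P? : Decidable P) xs →
                    length xs ≡ length (filter P? xs) + length (filter (¬? ∘ P?) xs)
  length-filter-∁ P? [] = refl
  length-filter-∁ P? (x ∷ xs) with P? x
  ... | yes _ = cong suc (length-filter-∁ P? xs)
  ... | no  _ = trans (cong suc (length-filter-∁ P? xs)) (sym (+-suc _ _))

module _ {A B : Set} where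

  Unique-map⁺ : ∀ (f : A → B) {xs} → (∀ {x y} → x ∈ xs → y ∈ xs → f x ≡ f y → x ≡ y) →
                Unique xs → Unique (map f xs)
  Unique-map⁺ f inj [] = []
  Unique-map⁺ f {x ∷ xs} inj (x≢xs ∷ u) =
    All.tabulate x≢ ∷ Unique-map⁺ f (λ y∈ z∈ → inj (there y∈) (there z∈)) u
    where
    x≢ : ∀ {z} → z ∈ map f xs → f x ≢ z
    x≢ z∈ fx≡z with y , y∈ , refl ← ∈-map⁻ f z∈ = All.lookup x≢xs y∈ (inj (here refl) (there y∈) fx≡z)

  Unique-concatMap⁺ : ∀ (f : A → List B) {xs} → Unique xs → (∀ x → Unique (f x)) →
                      (∀ {x y z} → z ∈ f x → z ∈ f y → x ≡ y) → Unique (concatMap f xs)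
  Unique-concatMap⁺ f [] _ _ = []
  Unique-concatMap⁺ f {x ∷ xs} (x≢xs ∷ u) uf sep =
    Unique.++⁺ (uf x) (Unique-concatMap⁺ f u uf sep) disjoint
    where
    disjoint : Disjoint (f x) (concatMap f xs)
    disjoint (z∈fx , z∈rest) with y , y∈xs , z∈fy ← find (∈-concatMap⁻ f {xs = xs} z∈rest) =
      All.lookup x≢xs y∈xs (sep z∈fx z∈fy)

  length-cartesianProduct : ∀ (xs : List A) (ys : List B) →
                            length (cartesianProduct xs ys) ≡ length xs * length ys
  length-cartesianProduct [] ys = refl
  length-cartesianProduct (x ∷ xs) ys = begin
    length (map (x ,_) ys ++ cartesianProduct xs ys)       ≡⟨ length-++ (map (x ,_) ys) ⟩
    length (map (x ,_) ys) + length (cartesianProduct xs ys) ≡⟨ cong₂ _+_ (length-map (x ,_) ys) (length-cartesianProduct xs ys) ⟩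
    length ys + length xs * length ys                      ∎
    where open ≡-Reasoning

  length-≤-injection : ∀ (f : A → B) {xs ys} → Unique xs → (∀ {x} → x ∈ xs → f x ∈ ys) →
                       (∀ {x y} → x ∈ xs → y ∈ xs → f x ≡ f y → x ≡ y) → length xs ≤ length ys
  length-≤-injection f {xs} {ys} u into inj =
    subst (_≤ length ys) (length-map f xs) (⊆⇒length-≤ (Unique-map⁺ f inj u) image⊆ys)
    where
    image⊆ys : map f xs ⊆ ys
    image⊆ys z∈ with x , x∈ , refl ← ∈-map⁻ f z∈ = into x∈

  length-concatMap-linear-≤ : ∀ {C : Set} (c d : ℕ) (f : A → List B) (g : A → List C) xs →
    (∀ {x} → x ∈ xs → c * length (f x) ≤ c * length (g x) + d * length (f x)) →
    c * length (concatMap f xs) ≤ c * length (concatMap g xs) + d * length (concatMap f xs)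
  length-concatMap-linear-≤ c d f g [] _ = ≤-reflexive (trans (*-zeroʳ c) (sym (cong₂ _+_ (*-zeroʳ c) (*-zeroʳ d))))
  length-concatMap-linear-≤ c d f g (x ∷ xs) bound = begin
    c * length (f x ++ concatMap f xs)      ≡⟨ cong (c *_) (length-++ (f x)) ⟩
    c * (a + a′)                            ≤⟨ split ⟩
    c * (b + b′) + d * (a + a′)             ≡⟨ cong₂ (λ s t → c * s + d * t) (length-++ (g x)) (length-++ (f x)) ⟨
    c * length (g x ++ concatMap g xs) + d * length (f x ++ concatMap f xs) ∎
    where
    open ≤-Reasoning
    a = length (f x) ; a′ = length (concatMap f xs)
    b = length (g x) ; b′ = length (concatMap g xs)
    split : c * (a + a′) ≤ c * (b + b′) + d * (a + a′)
    split = begin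
      c * (a + a′)                   ≡⟨ *-distribˡ-+ c a a′ ⟩
      c * a + c * a′                 ≤⟨ +-mono-≤ (bound (here refl)) (length-concatMap-linear-≤ c d f g xs (bound ∘ there)) ⟩
      (c * b + d * a) + (c * b′ + d * a′) ≡⟨ regroup c d a a′ b b′ ⟩
      c * (b + b′) + d * (a + a′)    ∎
      where
      regroup : ∀ c d a a′ b b′ → (c * b + d * a) + (c * b′ + d * a′) ≡ c * (b + b′) + d * (a + a′)
      regroup = solve-∀

divMod-unique : ∀ {d e e′ t t′} → e < d → e′ < d → e + t * d ≡ e′ + t′ * d → e ≡ e′ × t ≡ t′
divMod-unique {d} {e} {e′} {t} {t′} e<d e′<d eq = e≡e′ , t≡t′
  where
  instance
    d≢0 : NonZero d
    d≢0 = >-nonZero (≤-<-trans z≤n e<d)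
  e≡e′ : e ≡ e′
  e≡e′ = begin
    e                ≡⟨ m<n⇒m%n≡m e<d ⟨
    e % d            ≡⟨ [m+kn]%n≡m%n e t d ⟨
    (e + t * d) % d  ≡⟨ cong (_% d) eq ⟩
    (e′ + t′ * d) % d ≡⟨ [m+kn]%n≡m%n e′ t′ d ⟩
    e′ % d           ≡⟨ m<n⇒m%n≡m e′<d ⟩
    e′               ∎
    where open ≡-Reasoning
  t≡t′ : t ≡ t′
  t≡t′ = *-cancelʳ-≡ t t′ d (+-cancelˡ-≡ e _ _ (trans eq (cong (_+ t′ * d) (sym e≡e′))))

-- Squeezes each block [tW, tW + W) onto [tw, tw + w); one-to-one on the residues below w.
compress : (w W : ℕ) .⦃ _ : NonZero W ⦄ → ℕ → ℕ
compress w W u = u % W + u / W * w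

module _ {w W : ℕ} .⦃ _ : NonZero W ⦄ where

  compress-injective : ∀ {u u′} → u % W < w → u′ % W < w → compress w W u ≡ compress w W u′ → u ≡ u′
  compress-injective {u} {u′} r<w r′<w eq with r≡r′ , t≡t′ ← divMod-unique {t = u / W} {t′ = u′ / W} r<w r′<w eq = begin
    u                   ≡⟨ m≡m%n+[m/n]*n u W ⟩
    u % W + u / W * W   ≡⟨ cong₂ (λ r t → r + t * W) r≡r′ t≡t′ ⟩
    u′ % W + u′ / W * W ≡⟨ m≡m%n+[m/n]*n u′ W ⟨
    u′                  ∎
    where open ≡-Reasoning

  compress-< : ∀ {u N} → u < N * W → u % W < w → compress w W u < N * w
  compress-< {u} {N} u<NW r<w = begin-strict
    u % W + u / W * w   <⟨ +-monoˡ-< (u / W * w) r<w ⟩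
    suc (u / W) * w     ≤⟨ *-monoˡ-≤ w (m<n*o⇒m/o<n {n = N} u<NW) ⟩
    N * w               ∎
    where open ≤-Reasoning

Good⇔ : ∀ {K m k l q v} → K ∸ k ≡ suc l → m ≡ q * suc l → Good K m k v ⇔ v < q * l
Good⇔ {K} {m} {k} {l} {q} {v} K∸k≡L refl rewrite K∸k≡L = mk⇔ to from
  where
  L = suc l
  reshape : v * L + q * L < q * L * L ⇔ v + q < q * L
  reshape = mk⇔ (λ lt → *-cancelʳ-< L (v + q) (q * L) (subst (_< q * L * L) (sym (*-distribʳ-+ L v q)) lt))
                (λ lt → subst (_< q * L * L) (*-distribʳ-+ L v q) (*-monoˡ-< L lt))
  to : v * L + q * L < q * L * L → v < q * l
  to lt = +-cancelˡ-< q v (q * l) (subst₂ _<_ (+-comm v q) (*-suc q l) (Equivalence.to reshape lt))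
  from : v < q * l → v * L + q * L < q * L * L
  from lt = Equivalence.from reshape (subst₂ _<_ (+-comm q v) (sym (*-suc q l)) (+-monoʳ-< q lt))

WtCond⇔ : ∀ {m n K W k l w} .⦃ _ : NonZero W ⦄ {x : Point m n} → K ∸ k ≡ suc l → W ≡ w * suc l →
          WtCond K W k x ⇔ wt x % W < w
WtCond⇔ {K = K} {W} {k} {l} {w} {x} K∸k≡L W≡wL = mk⇔
  (λ c → *-cancelʳ-< (suc l) (wt x % W) w (subst₂ _<_ (cong (wt x % W *_) K∸k≡L) W≡wL c))
  (λ r<w → subst₂ _<_ (cong (wt x % W *_) (sym K∸k≡L)) (sym W≡wL) (*-monoˡ-< (suc l) r<w))

wtOff : ∀ {m n} → Fin n → Point m n → ℕ
wtOff fzero    (a ∷ x) = wt x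
wtOff (fsuc j) (a ∷ x) = toℕ a + wtOff j x

wt-split : ∀ {m n} (j : Fin n) (x : Point m n) → wt x ≡ wtOff j x + toℕ (lookup x j)
wt-split fzero    (a ∷ x) = +-comm (toℕ a) (wt x)
wt-split (fsuc j) (a ∷ x) = trans (cong (toℕ a +_) (wt-split j x)) (sym (+-assoc (toℕ a) _ _))

wtOff-update : ∀ {m n} (j : Fin n) (x : Point m n) v → wtOff j (x [ j ]≔ v) ≡ wtOff j x
wtOff-update fzero    (a ∷ x) v = refl
wtOff-update (fsuc j) (a ∷ x) v = cong (toℕ a +_) (wtOff-update j x v)

[]≔-injective : ∀ {A : Set} {n} {x x′ : Vec A n} {j v v′} →
                x [ j ]≔ v ≡ x′ [ j ]≔ v′ → lookup x j ≡ lookup x′ j → x ≡ x′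
[]≔-injective {x = x} {x′} {j} {v} {v′} eq eqⱼ = begin
  x                                ≡⟨ []≔-lookup x j ⟨
  x [ j ]≔ lookup x j              ≡⟨ []≔-idempotent x j ⟨
  (x [ j ]≔ v) [ j ]≔ lookup x j   ≡⟨ cong₂ (λ y a → y [ j ]≔ a) eq eqⱼ ⟩
  (x′ [ j ]≔ v′) [ j ]≔ lookup x′ j ≡⟨ []≔-idempotent x′ j ⟩
  x′ [ j ]≔ lookup x′ j            ≡⟨ []≔-lookup x′ j ⟩
  x′                               ∎
  where open ≡-Reasoning

toℕ-mod : ∀ {v m} .⦃ _ : NonZero m ⦄ → v < m → toℕ (v mod m) ≡ v
toℕ-mod {v} {m} v<m = trans (toℕ-fromℕ< _) (m<n⇒m%n≡m v<m)

allPoints-complete : ∀ m n (x : Point m n) → x ∈ allPoints m n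
allPoints-complete m zero    []      = here refl
allPoints-complete m (suc n) (a ∷ x) =
  ∈-concatMap⁺ (λ b → map (b ∷_) (allPoints m n)) (lose (∈-allFin a) (∈-map⁺ (a ∷_) (allPoints-complete m n x)))

allPoints-unique : ∀ m n → Unique (allPoints m n)
allPoints-unique m zero    = [] ∷ []
allPoints-unique m (suc n) =
  Unique-concatMap⁺ (λ a → map (a ∷_) (allPoints m n)) (Unique.allFin⁺ m)
    (λ a → Unique.map⁺ (proj₂ ∘ ∷-injective) (allPoints-unique m n)) same-head
  where
  same-head : ∀ {a b z} → z ∈ map (a ∷_) (allPoints m n) → z ∈ map (b ∷_) (allPoints m n) → a ≡ b
  same-head {a} {b} z∈a z∈b with _ , _ , refl ← ∈-map⁻ (a ∷_) z∈a | _ , _ , eq ← ∈-map⁻ (b ∷_) z∈b =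
    proj₁ (∷-injective eq)

module _ {n} {K m : ℕ} {J : ℕ → Fin n} where

  InT-update : ∀ k {j x v} → (∀ i → i < k → J i ≢ j) → InT K m J k x → InT K m J k (x [ j ]≔ v)
  InT-update zero    _     _       = tt
  InT-update (suc k) {j} {x} {v} fresh (p , good) =
    InT-update k (λ i i<k → fresh i (m<n⇒m<1+n i<k)) p ,
    subst (Good K m k ∘ toℕ) (sym (lookup∘update′ (fresh k ≤-refl) x v)) good

  InT-antitone : ∀ {i k} {y : Point m n} → i ≤ k → InT K m J k y → InT K m J i y
  InT-antitone {zero}              _         _          = tt
  InT-antitone {suc i} {suc k} (s≤s i≤k) (p , good) with m≤n⇒m<n∨m≡n i≤k
  ... | inj₁ i<k  = InT-antitone i<k p
  ... | inj₂ refl = p , good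

  InT-layer-unique : ∀ {k k′} {y : Point m n} → InT K m J k y → ¬ InT K m J (suc k) y →
                     InT K m J k′ y → ¬ InT K m J (suc k′) y → k ≡ k′
  InT-layer-unique {k} {k′} y∈k y∉k+1 y∈k′ y∉k′+1 with <-cmp k k′
  ... | tri< k<k′ _ _ = contradiction (InT-antitone k<k′ y∈k′) y∉k+1
  ... | tri≈ _ k≡k′ _ = k≡k′
  ... | tri> _ _ k′<k = contradiction (InT-antitone k′<k y∈k) y∉k′+1

module Construction {n} (h m W : ℕ) ⦃ _ : NonZero m ⦄ ⦃ _ : NonZero W ⦄
                    (J : ℕ → Fin n) (D : ℕ → Subset n) where

  K : ℕ
  K = 2 * h

  S : ℕ → List (Point m n)
  S k = filter (inS? K m W J k) (allPoints m n)

  record LayerMatching (k : ℕ) : Set where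
    field
      pairs          : List (Point m n × Point m n)
      edges          : All (λ p → IsEdge h K W J D (k , proj₁ p) (proj₂ p)) pairs
      leave          : All (λ p → ¬ InT K m J (suc k) (proj₂ p)) pairs
      sources-unique : Unique (map proj₁ pairs)
      targets-unique : Unique (map proj₂ pairs)

  open LayerMatching

  emptyLayerMatching : ∀ {k} → LayerMatching k
  emptyLayerMatching = record { pairs = [] ; edges = [] ; leave = [] ; sources-unique = [] ; targets-unique = [] }

  Covers : ∀ {k} → LayerMatching k → Set
  Covers {k} M = K * length (S k) ≤ K * length (pairs M) + 2 * length (S k)

  record LayerShape (k : ℕ) : Set where
    field
      l w r : ℕ
      K∸k≡L : K ∸ k ≡ suc l
      W≡wL  : W ≡ w * suc l
      m≡qL  : m ≡ r * W * suc l
      r≥1   : 1 ≤ r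
      h≤L   : h ≤ suc l

  layerShape : ∀ {k} → k < h → (K ∸ k) ∣ W → (W * (K ∸ k)) ∣ m → LayerShape k
  layerShape {k} k<h (divides w W≡) (divides r m≡) = record
    { l = K ∸ suc k ; w = w ; r = r
    ; K∸k≡L = K∸k≡L
    ; W≡wL  = trans W≡ (cong (w *_) K∸k≡L)
    ; m≡qL  = trans m≡ (trans (cong (λ L → r * (W * L)) K∸k≡L) (sym (*-assoc r W _)))
    ; r≥1   = r≥1 r m≡
    ; h≤L   = subst (h ≤_) K∸k≡L (subst (_≤ K ∸ k) K∸h≡h (∸-monoʳ-≤ K (<⇒≤ k<h)))
    }
    where
    K∸h≡h : K ∸ h ≡ h
    K∸h≡h = trans (m+n∸m≡n h (h + 0)) (+-identityʳ h)
    K∸k≡L : K ∸ k ≡ suc (K ∸ suc k)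
    K∸k≡L = +-∸-assoc 1 (≤-trans k<h (m≤m+n h (h + 0)))
    r≥1 : ∀ r → m ≡ r * (W * (K ∸ k)) → 1 ≤ r
    r≥1 zero    m≡0 = contradiction m≡0 (≢-nonZero⁻¹ m)
    r≥1 (suc _) _   = s≤s z≤n

  module Layer (k : ℕ) (k<h : k < h) (Jₖ-fresh : ∀ i → i < k → J i ≢ J k) (Jₖ∈Dₖ : J k ∈ₛ D k)
               (shape : LayerShape k) where

    open LayerShape shape

    L q : ℕ
    L = suc l
    q = r * W

    m≡q+ql : m ≡ q + q * l
    m≡q+ql = trans m≡qL (*-suc q l)

    coord : Point m n → ℕ
    coord x = toℕ (lookup x (J k))

    setCoord : ℕ → Point m n → Point m n
    setCoord v x = x [ J k ]≔ (v mod m)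

    coord-setCoord : ∀ {v} x → v < m → coord (setCoord v x) ≡ v
    coord-setCoord {v} x v<m = trans (cong toℕ (lookup∘update (J k) x (v mod m))) (toℕ-mod v<m)

    wt-setCoord : ∀ {v} x → v < m → wt (setCoord v x) ≡ wtOff (J k) x + v
    wt-setCoord {v} x v<m =
      trans (wt-split (J k) (setCoord v x)) (cong₂ _+_ (wtOff-update (J k) x _) (coord-setCoord x v<m))

    good⇔ : ∀ {v} → Good K m k v ⇔ v < q * l
    good⇔ = Good⇔ {K} {m} {k} {q = q} K∸k≡L m≡qL

    wtCond⇔ : ∀ {x : Point m n} → WtCond K W k x ⇔ wt x % W < w
    wtCond⇔ {x} = WtCond⇔ {K = K} {k = k} {x = x} K∸k≡L W≡wL

    G B : List (Point m n)
    G = filter (good? K m k ∘ coord) (S k)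
    B = filter (¬? ∘ good? K m k ∘ coord) (S k)

    S-unique : Unique (S k)
    S-unique = Unique.filter⁺ (inS? K m W J k) (allPoints-unique m n)

    ∈S⁺ : ∀ {x} → InS K m W J k x → x ∈ S k
    ∈S⁺ {x} = ∈-filter⁺ (inS? K m W J k) (allPoints-complete m n x)

    ∈G⁻ : ∀ {x} → x ∈ G → InS K m W J k x × coord x < q * l
    ∈G⁻ x∈G with x∈S , good ← ∈-filter⁻ (good? K m k ∘ coord) {xs = S k} x∈G =
      proj₂ (∈-filter⁻ (inS? K m W J k) {xs = allPoints m n} x∈S) , Equivalence.to good⇔ good

    ∈B⁻ : ∀ {x} → x ∈ B → InS K m W J k x × q * l ≤ coord x
    ∈B⁻ x∈B with x∈S , bad ← ∈-filter⁻ (¬? ∘ good? K m k ∘ coord) {xs = S k} x∈B =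
      proj₂ (∈-filter⁻ (inS? K m W J k) {xs = allPoints m n} x∈S) , ≮⇒≥ (bad ∘ Equivalence.from good⇔)

    residue : Point m n → ℕ
    residue x = wtOff (J k) x % W + coord x

    residue-%W : ∀ x → residue x % W ≡ wt x % W
    residue-%W x = begin
      (c % W + coord x) % W             ≡⟨ [m+kn]%n≡m%n _ (c / W) W ⟨
      (c % W + coord x + c / W * W) % W ≡⟨ cong (_% W) (+-right-comm (c % W) (coord x) _) ⟩
      (c % W + c / W * W + coord x) % W ≡⟨ cong (λ c′ → (c′ + coord x) % W) (m≡m%n+[m/n]*n c W) ⟨
      (c + coord x) % W                 ≡⟨ cong (_% W) (wt-split (J k) x) ⟨
      wt x % W                          ∎
      where
      open ≡-Reasoning
      c = wtOff (J k) x

    residue%W<w : ∀ {x} → InS K m W J k x → residue x % W < w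
    residue%W<w {x} (_ , wtCond) = subst (_< w) (sym (residue-%W x)) (Equivalence.to (wtCond⇔ {x}) wtCond)

    lift : Point m n → ℕ
    lift x = q * l + compress w W (residue x)

    target : Point m n → Point m n
    target x = setCoord (lift x) x

    lift-< : ∀ {x} → x ∈ G → lift x < m
    lift-< {x} x∈G = begin-strict
      q * l + compress w W (residue x) <⟨ +-monoʳ-< (q * l) (compress-< {N = suc (r * l)} residue< (residue%W<w inS)) ⟩
      q * l + suc (r * l) * w          ≤⟨ +-monoʳ-≤ (q * l) compressed≤q ⟩
      q * l + q                        ≡⟨ trans (+-comm (q * l) q) (sym m≡q+ql) ⟩
      m                                ∎
      where
      open ≤-Reasoning
      inS = proj₁ (∈G⁻ x∈G)
      residue< : residue x < suc (r * l) * W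
      residue< = subst (residue x <_) (W+rWl≡ r W l)
                   (+-mono-< (m%n<n (wtOff (J k) x) W) (proj₂ (∈G⁻ x∈G)))
        where
        W+rWl≡ : ∀ r W l → W + r * W * l ≡ suc (r * l) * W
        W+rWl≡ = solve-∀
      compressed≤q : suc (r * l) * w ≤ q
      compressed≤q = begin
        suc (r * l) * w  ≤⟨ +-monoˡ-≤ (r * l * w) (subst (_≤ r * w) (+-identityʳ w) (*-monoˡ-≤ w r≥1)) ⟩
        r * w + r * l * w ≡⟨ rw+rlw≡ r w l ⟩
        r * (w * suc l)  ≡⟨ cong (r *_) W≡wL ⟨
        q                ∎
        where
        rw+rlw≡ : ∀ r w l → r * w + r * l * w ≡ r * (w * suc l)
        rw+rlw≡ = solve-∀

    target-leaves : ∀ {x} → x ∈ G → ¬ Good K m k (coord (target x))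
    target-leaves {x} x∈G good = <⇒≱ (Equivalence.to good⇔ good)
      (subst (q * l ≤_) (sym (coord-setCoord x (lift-< x∈G))) (m≤m+n (q * l) _))

    target-injective : ∀ {x x′} → x ∈ G → x′ ∈ G → target x ≡ target x′ → x ≡ x′
    target-injective {x} {x′} x∈G x′∈G eq = []≔-injective eq (toℕ-injective coord≡)
      where
      lift≡ : lift x ≡ lift x′
      lift≡ = trans (sym (coord-setCoord x (lift-< x∈G)))
                (trans (cong coord eq) (coord-setCoord x′ (lift-< x′∈G)))
      residue≡ : residue x ≡ residue x′
      residue≡ = compress-injective (residue%W<w (proj₁ (∈G⁻ x∈G))) (residue%W<w (proj₁ (∈G⁻ x′∈G)))
                   (+-cancelˡ-≡ (q * l) _ _ lift≡)
      wtOff≡ : wtOff (J k) x ≡ wtOff (J k) x′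
      wtOff≡ = trans (sym (wtOff-update (J k) x _))
                 (trans (cong (wtOff (J k)) eq) (wtOff-update (J k) x′ _))
      coord≡ : coord x ≡ coord x′
      coord≡ = +-cancelˡ-≡ (wtOff (J k) x % W) _ _
                 (trans residue≡ (cong (λ c → c % W + coord x′) (sym wtOff≡)))

    target-edge : ∀ {x} → x ∈ G → IsEdge h K W J D (k , x) (target x)
    target-edge {x} x∈G with inS@(inT , _) , good ← ∈G⁻ x∈G =
      k<h , inS , InT-update k Jₖ-fresh inT ,
      J k , Jₖ∈Dₖ , Equivalence.from good⇔ good , target-leaves x∈G ,
      λ i i≢Jₖ → sym (lookup∘update′ i≢Jₖ x _)

    goodMatching : LayerMatching k
    goodMatching = record
      { pairs          = map (λ x → x , target x) G
      ; edges          = All.map⁺ (All.tabulate target-edge)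
      ; leave          = All.map⁺ (All.tabulate (λ x∈G → target-leaves x∈G ∘ proj₂))
      ; sources-unique = subst Unique (trans (sym (map-id G)) (map-∘ G)) G-unique
      ; targets-unique = subst Unique (map-∘ G) (Unique-map⁺ target target-injective G-unique)
      }
      where
      G-unique : Unique G
      G-unique = Unique.filter⁺ (good? K m k ∘ coord) S-unique

    offset : Point m n → ℕ
    offset x = coord x ∸ q * l

    spread : ℕ → Point m n → Point m n
    spread j x = setCoord (offset x + j * q) x

    coord≡offset+lq : ∀ {x} → x ∈ B → coord x ≡ offset x + l * q
    coord≡offset+lq {x} x∈B = trans (sym (m∸n+n≡m (proj₂ (∈B⁻ x∈B)))) (cong (offset x +_) (*-comm q l))

    offset<q : ∀ {x} → x ∈ B → offset x < q
    offset<q {x} x∈B = +-cancelʳ-< (q * l) (offset x) q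
      (subst₂ _<_ (sym (m∸n+n≡m (proj₂ (∈B⁻ x∈B)))) m≡q+ql (toℕ<n (lookup x (J k))))

    spread-< : ∀ {x j} → x ∈ B → j < L → offset x + j * q < m
    spread-< {x} {j} x∈B j<L = begin-strict
      offset x + j * q <⟨ +-monoˡ-< (j * q) (offset<q x∈B) ⟩
      suc j * q        ≤⟨ *-monoˡ-≤ q j<L ⟩
      L * q            ≡⟨ *-comm L q ⟩
      q * L            ≡⟨ m≡qL ⟨
      m                ∎
      where open ≤-Reasoning

    +-multiple-%W : ∀ c e t → (c + (e + t * q)) % W ≡ (c + e) % W
    +-multiple-%W c e t = trans (cong (_% W) (regroup c e t r W)) ([m+kn]%n≡m%n (c + e) (t * r) W)
      where
      regroup : ∀ c e t r W → c + (e + t * (r * W)) ≡ c + e + t * r * W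
      regroup = solve-∀

    spread-∈S : ∀ {x j} → x ∈ B → j < L → spread j x ∈ S k
    spread-∈S {x} {j} x∈B j<L with (inT , wtCond) , _ ← ∈B⁻ x∈B =
      ∈S⁺ (InT-update k Jₖ-fresh inT , Equivalence.from (wtCond⇔ {spread j x}) (subst (_< w) wt%W≡ (Equivalence.to (wtCond⇔ {x}) wtCond)))
      where
      c = wtOff (J k) x
      wt%W≡ : wt x % W ≡ wt (spread j x) % W
      wt%W≡ = begin
        wt x % W                          ≡⟨ cong (_% W) (wt-split (J k) x) ⟩
        (c + coord x) % W                 ≡⟨ cong (λ a → (c + a) % W) (coord≡offset+lq x∈B) ⟩
        (c + (offset x + l * q)) % W      ≡⟨ +-multiple-%W c (offset x) l ⟩
        (c + offset x) % W                ≡⟨ +-multiple-%W c (offset x) j ⟨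
        (c + (offset x + j * q)) % W      ≡⟨ cong (_% W) (wt-setCoord x (spread-< x∈B j<L)) ⟨
        wt (spread j x) % W               ∎
        where open ≡-Reasoning

    spread-injective : ∀ {x x′ j j′} → x ∈ B → x′ ∈ B → j < L → j′ < L →
                       spread j x ≡ spread j′ x′ → (j , x) ≡ (j′ , x′)
    spread-injective {x} {x′} {j} {j′} x∈B x′∈B j<L j′<L eq =
      cong₂ _,_ (proj₂ digits≡) ([]≔-injective eq (toℕ-injective coord≡))
      where
      open ≡-Reasoning
      digits≡ : offset x ≡ offset x′ × j ≡ j′
      digits≡ = divMod-unique (offset<q x∈B) (offset<q x′∈B) (begin
        offset x + j * q            ≡⟨ coord-setCoord x (spread-< x∈B j<L) ⟨
        coord (spread j x)          ≡⟨ cong coord eq ⟩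
        coord (spread j′ x′)        ≡⟨ coord-setCoord x′ (spread-< x′∈B j′<L) ⟩
        offset x′ + j′ * q          ∎)
      coord≡ : coord x ≡ coord x′
      coord≡ = begin
        coord x            ≡⟨ coord≡offset+lq x∈B ⟩
        offset x + l * q   ≡⟨ cong (_+ l * q) (proj₁ digits≡) ⟩
        offset x′ + l * q  ≡⟨ coord≡offset+lq x′∈B ⟨
        coord x′           ∎

    B-small : L * length B ≤ length (S k)
    B-small = subst (_≤ length (S k)) (trans (length-cartesianProduct (upTo L) B) (cong (_* length B) (length-upTo L)))
      (length-≤-injection (λ p → spread (proj₁ p) (proj₂ p))
        (Unique.cartesianProduct⁺ (Unique.upTo⁺ L) B-unique)
        (λ p∈ → let j∈ , x∈B = ∈-cartesianProduct⁻ (upTo L) B p∈ in spread-∈S x∈B (∈-upTo⁻ j∈))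
        (λ p∈ p′∈ → let j∈ , x∈B = ∈-cartesianProduct⁻ (upTo L) B p∈
                        j′∈ , x′∈B = ∈-cartesianProduct⁻ (upTo L) B p′∈
                    in spread-injective x∈B x′∈B (∈-upTo⁻ j∈) (∈-upTo⁻ j′∈)))
      where
      B-unique : Unique B
      B-unique = Unique.filter⁺ (¬? ∘ good? K m k ∘ coord) S-unique

    goodMatching-covers : Covers goodMatching
    goodMatching-covers = begin
      K * length (S k)                   ≡⟨ cong (K *_) (length-filter-∁ (good? K m k ∘ coord) (S k)) ⟩
      K * (length G + length B)          ≡⟨ *-distribˡ-+ K (length G) (length B) ⟩
      K * length G + K * length B        ≤⟨ +-monoʳ-≤ (K * length G) K|B|≤2|S| ⟩
      K * length G + 2 * length (S k)    ≡⟨ cong (λ g → K * g + 2 * length (S k)) (length-map (λ x → x , target x) G) ⟨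
      K * length (pairs goodMatching) + 2 * length (S k) ∎
      where
      open ≤-Reasoning
      K|B|≤2|S| : K * length B ≤ 2 * length (S k)
      K|B|≤2|S| = begin
        2 * h * length B    ≡⟨ *-assoc 2 h (length B) ⟩
        2 * (h * length B)  ≤⟨ *-monoʳ-≤ 2 (*-monoˡ-≤ (length B) h≤L) ⟩
        2 * (L * length B)  ≤⟨ *-monoʳ-≤ 2 B-small ⟩
        2 * length (S k)    ∎

    layerMatching : Σ (LayerMatching k) Covers
    layerMatching = goodMatching , goodMatching-covers

  Edge : Set
  Edge = (ℕ × Point m n) × Point m n

  matching : (∀ k → k < h → Σ (LayerMatching k) Covers) →
             Σ (List Edge) λ M → IsMatchingIntoT∖T* h K W J D M × K * sizeS h K m W J ≤ K * length M + 2 * sizeS h K m W J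
  matching layer = M , (M-edges , M-sources-unique , M-targets-unique , M-avoids-T*) , M-covers
    where
    layer′ : ∀ k → LayerMatching k
    layer′ k with k <? h
    ... | yes k<h = proj₁ (layer k k<h)
    ... | no  _   = emptyLayerMatching

    layer′-covers : ∀ k → k < h → Covers (layer′ k)
    layer′-covers k k<h with k <? h
    ... | yes k<h′ = proj₂ (layer k k<h′)
    ... | no  k≮h  = contradiction k<h k≮h

    edgesOf : ℕ → List Edge
    edgesOf k = map (λ p → (k , proj₁ p) , proj₂ p) (pairs (layer′ k))

    M : List Edge
    M = concatMap edgesOf (upTo h)

    All-M : ∀ {P : Pred Edge 0ℓ} → (∀ k → All P (edgesOf k)) → All P M
    All-M all = All.concat⁺ (All.map⁺ (All.universal all (upTo h)))

    M-edges : All (λ e → IsEdge h K W J D (proj₁ e) (proj₂ e)) M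
    M-edges = All-M λ k → All.map⁺ (edges (layer′ k))

    M-avoids-T* : All (λ e → ¬ InT K m J h (proj₂ e)) M
    M-avoids-T* = All-M λ k → All.map⁺ (All.zipWith
      (λ (edge , leaves) y∈T* → leaves (InT-antitone (proj₁ edge) y∈T*))
      (edges (layer′ k) , leave (layer′ k)))

    M-sources-unique : Unique (map proj₁ M)
    M-sources-unique = subst Unique (sym (map-concatMap proj₁ edgesOf (upTo h)))
      (Unique-concatMap⁺ (map proj₁ ∘ edgesOf) (Unique.upTo⁺ h) sources-unique′ same-index)
      where
      sources-unique′ : ∀ k → Unique (map proj₁ (edgesOf k))
      sources-unique′ k = subst Unique (trans (sym (map-∘ ps)) (map-∘ ps))
                            (Unique.map⁺ (cong proj₂) (sources-unique (layer′ k)))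
        where ps = pairs (layer′ k)
      index-in : ∀ k → All (λ s → proj₁ s ≡ k) (map proj₁ (edgesOf k))
      index-in k = All.map⁺ (All.map⁺ (All.universal (λ _ → refl) (pairs (layer′ k))))
      same-index : ∀ {k k′ s} → s ∈ map proj₁ (edgesOf k) → s ∈ map proj₁ (edgesOf k′) → k ≡ k′
      same-index {k} {k′} s∈ s∈′ = trans (sym (All.lookup (index-in k) s∈)) (All.lookup (index-in k′) s∈′)

    M-targets-unique : Unique (map proj₂ M)
    M-targets-unique = subst Unique (sym (map-concatMap proj₂ edgesOf (upTo h)))
      (Unique-concatMap⁺ (map proj₂ ∘ edgesOf) (Unique.upTo⁺ h) targets-unique′ same-layer)
      where
      targets-unique′ : ∀ k → Unique (map proj₂ (edgesOf k))
      targets-unique′ k = subst Unique (map-∘ (pairs (layer′ k))) (targets-unique (layer′ k))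
      layer-in : ∀ k → All (λ y → InT K m J k y × ¬ InT K m J (suc k) y) (map proj₂ (edgesOf k))
      layer-in k = All.map⁺ (All.map⁺ (All.zipWith (λ (edge , leaves) → proj₁ (proj₂ (proj₂ edge)) , leaves)
                                                    (edges (layer′ k) , leave (layer′ k))))
      same-layer : ∀ {k k′ y} → y ∈ map proj₂ (edgesOf k) → y ∈ map proj₂ (edgesOf k′) → k ≡ k′
      same-layer {k} {k′} y∈ y∈′ with y∈Tₖ , y∉Tₖ₊₁ ← All.lookup (layer-in k) y∈
                                   | y∈Tₖ′ , y∉Tₖ′₊₁ ← All.lookup (layer-in k′) y∈′ =
        InT-layer-unique y∈Tₖ y∉Tₖ₊₁ y∈Tₖ′ y∉Tₖ′₊₁

    M-covers : K * sizeS h K m W J ≤ K * length M + 2 * sizeS h K m W J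
    M-covers = length-concatMap-linear-≤ K 2 (λ k → map (k ,_) (S k)) edgesOf (upTo h) covers
      where
      covers : ∀ {k} → k ∈ upTo h →
               K * length (map (k ,_) (S k)) ≤ K * length (edgesOf k) + 2 * length (map (k ,_) (S k))
      covers {k} k∈ rewrite length-map (k ,_) (S k) | length-map (λ p → (k , proj₁ p) , proj₂ p) (pairs (layer′ k)) =
        layer′-covers k (∈-upTo⁻ k∈)

mainTheorem8 :
  ∃[ C ] (∀ (h n m W : ℕ) → ⦃ _ : NonZero W ⦄ → 1 ≤ h → 1 ≤ m
    → (∀ s → s < h → ((2 * h ∸ s) ∣ W) × ((W * (2 * h ∸ s)) ∣ m))
    → (J : ℕ → Fin n)
    → (∀ i i′ → i ≤ h → i′ ≤ h → J i ≡ J i′ → i ≡ i′)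
    → (D : ℕ → Subset n)
    → (∀ k → k < h → J k ∈ₛ D k)
    → (∀ k i → k < h → i ≤ h → i ≢ k → J i ∉ₛ D k)
    → Σ (List ((ℕ × Point m n) × Point m n)) (λ M →
        IsMatchingIntoT∖T* h (2 * h) W J D M
        × (2 * h) * sizeS h (2 * h) m W J ≤ (2 * h) * length M + C * sizeS h (2 * h) m W J))
mainTheorem8 = 2 , λ h n m W _ m≥1 divisible J J-injective D Jₖ∈Dₖ _ →
  let open Construction h m W ⦃ >-nonZero m≥1 ⦄ J D in
  matching λ k k<h →
    let Jₖ-fresh i i<k = <⇒≢ i<k ∘ J-injective i k (<⇒≤ (<-trans i<k k<h)) (<⇒≤ k<h)
        shape = layerShape k<h (proj₁ (divisible k k<h)) (proj₂ (divisible k k<h))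
    in Layer.layerMatching k k<h Jₖ-fresh (Jₖ∈Dₖ k k<h) shape
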